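{- Let $G,H$ be finite simple graphs. If $G\searrow^{s} H$ (i.e. $H$ is obtained from $G$ by successive deletions of s-dismantlable vertices), then $\Delta_{\mathscr G}(G)$ collapses onto $\Delta_{\mathscr G}(H)$.
   Context: Graphs are finite, undirected, without loops or multiple edges. $N_G(g)$ is the set of neighbours of $g$, $N_G[g]=N_G(g)\cup\{g\}$; vertex sets are identified with induced subgraphs. A vertex $g$ is dominated by $g'\ne g$ if $N_G[g]\subseteq N_G[g']$. A graph is dismantlable if it has one vertex, or its vertices can be listed $g_1,\dots,g_n$ so that each $g_i$ ($2\le i\le n$) is dominated by another vertex in the subgraph induced by $\{g_1,\dots,g_i\}$. A vertex $g$ is s-dismantlable in $G$ if $N_G(g)$ is dismantlable; $G\searrow^s H$ means $H$ is obtained from $G$ by a finite sequence of deletions of vertices each s-dismantlable in the current graph. $\Delta_{\mathscr G}(G)$ is the simplicial complex whose simplices are the vertex sets of nonempty complete subgraphs of $G$. An elementary collapse removes a pair $(\sigma,\tau)$ of simplices with $\tau\subset\sigma$, $|\tau|=|\sigma|-1$, and $\sigma$ the only simplex properly containing $\tau$; $K$ collapses onto $L$ if $L$ is obtained from $K$ by a finite sequence of elementary collapses. -}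

module Defs where

open import Data.Nat using (ℕ; suc)
open import Data.Bool using (Bool; true; false)
open import Data.Fin using (Fin)
open import Data.Fin.Subset using (Subset; _∈_; _⊆_; _⊂_; _∩_; _-_; ⁅_⁆; ∣_∣; Nonempty; ⊤)
open import Data.Vec using (tabulate)
open import Data.Product using (_×_)
open import Data.Sum using (_⊎_)
open import Relation.Binary.PropositionalEquality using (_≡_; _≢_)

record Graph : Set where
  field
    size  : ℕ
    adj   : Fin size → Fin size → Bool
    sym   : ∀ u v → adj u v ≡ adj v u
    irrefl : ∀ v → adj v v ≡ false

open Graph public

-- Vertex subsets S of G are identified with the induced subgraphs G[S].
module _ (G : Graph) where

  V : Set
  V = Fin (size G)

  Adj : V → V → Set
  Adj u v = adj G u v ≡ true

  N : Subset (size G) → V → Subset (size G)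
  N S g = tabulate (adj G g) ∩ S

  InClosedN : V → V → Set
  InClosedN v u = u ≡ v ⊎ Adj v u

  Dominated : Subset (size G) → V → V → Set
  Dominated S v w = w ≢ v × (∀ u → u ∈ S → InClosedN v u → InClosedN w u)

  -- G[S] is dismantlable: it has one vertex, or its vertices can be listed
  -- g₁,…,g_k (k ≥ 2) with each gᵢ (i ≥ 2) dominated in G[{g₁,…,gᵢ}].
  -- Inductively: peel off the last vertex g_k, which is dominated in G[S].
  data Dismantlable (S : Subset (size G)) : Set where
    single : (v : V) → S ≡ ⁅ v ⁆ → Dismantlable S
    peel   : (v w : V) → v ∈ S → w ∈ S → Dominated S v w →
             Dismantlable (S - v) → Dismantlable S

  SDismantlable : Subset (size G) → V → Set
  SDismantlable S g = Dismantlable (N S g)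

  data _↘ˢ_ : Subset (size G) → Subset (size G) → Set where
    done : ∀ {S} → S ↘ˢ S
    del  : ∀ {S T} (g : V) → g ∈ S → SDismantlable S g → (S - g) ↘ˢ T → S ↘ˢ T

  CliqueComplex : Subset (size G) → Subset (size G) → Set
  CliqueComplex S σ = Nonempty σ × σ ⊆ S × (∀ u v → u ∈ σ → v ∈ σ → u ≢ v → Adj u v)

Complex : ℕ → Set₁
Complex n = Subset n → Set

data CollapsesOnto {n : ℕ} : Complex n → Complex n → Set₁ where
  same : ∀ {K L : Complex n} → (∀ ρ → (K ρ → L ρ) × (L ρ → K ρ)) → CollapsesOnto K L
  elem : ∀ {K L : Complex n} (σ τ : Subset n) →
         K σ → K τ → τ ⊆ σ → suc ∣ τ ∣ ≡ ∣ σ ∣ →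
         (∀ ρ → K ρ → τ ⊂ ρ → ρ ≡ σ) →
         CollapsesOnto (λ ρ → K ρ × ρ ≢ σ × ρ ≢ τ) L →
         CollapsesOnto K L

-- Write Δ(S) for the clique complex of G[S] and let g have dismantlable neighbourhood
-- N = N_S(g), so that Δ(S) = Δ(S - g) ∪ g ∗ Δ(N). Shrink N along its dismantling order,
-- keeping K_B = Δ(S - g) ∪ g ∗ Δ(B). If v is dominated by w in B, every simplex of K_B
-- through g and v extends by w, so the star of the edge gv is a cone with apex w and
-- collapses away, leaving K_(B - v). Once B = {v}, the star of g is a cone with apex v,
-- and collapsing it leaves Δ(S - g).

module Submission where

open import Defs hiding (sym)
open import Data.Bool as Bool using (true)
open import Data.Empty using (⊥-elim)
open import Data.Fin using (Fin; zero; suc)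
open import Data.Fin.Properties using (all?) renaming (_≟_ to _≟ᶠ_)
open import Data.Fin.Subset
open import Data.Fin.Subset.Properties
open import Data.Nat using (ℕ; zero; suc; _≤_; s≤s)
open import Data.Nat.Properties as ℕₚ using (≤-refl; ≤-trans; ≤-pred; <⇒≱)
open import Data.List as List using (List; []; _∷_; length; filter)
open import Data.List.Extrema ℕₚ.≤-totalOrder using (argmax; argmax-sel; f[⊥]≤f[argmax]; f[xs]≤f[argmax])
open import Data.List.Membership.Propositional using () renaming (_∈_ to _∈ₗ_)
open import Data.List.Membership.Propositional.Properties using (∈-filter⁺; ∈-filter⁻; ∈-map⁺; ∈-++⁺ˡ; ∈-++⁺ʳ)
open import Data.List.Properties using (filter-notAll)
open import Data.List.Relation.Unary.All as All using ()
open import Data.List.Relation.Unary.Any as Any using (here; there)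
open import Data.Product using (_×_; _,_; proj₁; proj₂; ∃)
open import Data.Sum using (_⊎_; inj₁; inj₂; [_,_]′)
open import Data.Vec using ([]; _∷_; here; there; tabulate)
open import Data.Vec.Properties using (≡-dec; lookup∘tabulate; []=⇒lookup; lookup⇒[]=)
open import Function using (id; _∘_; _⇔_; mk⇔; Equivalence)
open import Relation.Nullary using (¬_; Dec; yes; no; ¬?)
open import Relation.Nullary.Decidable using (_×-dec_; _→-dec_)
open import Relation.Unary using (Decidable)
open import Relation.Binary.PropositionalEquality

private
  variable
    n : ℕ
    p q : Subset n
    x y : Fin n

x∈p─q⇒x∉q : ∀ (p q : Subset n) → x ∈ p ─ q → x ∉ q
x∈p─q⇒x∉q {x = zero} (_ ∷ p) (inside ∷ q) ()
x∈p─q⇒x∉q {x = zero} (_ ∷ p) (outside ∷ q) here ()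
x∈p─q⇒x∉q (_ ∷ p) (_ ∷ q) (there x∈p─q) (there x∈q) = x∈p─q⇒x∉q p q x∈p─q x∈q

x∈p-y⇒x≢y : x ∈ p - y → x ≢ y
x∈p-y⇒x≢y {p = p} {y = y} x∈p-y refl = x∈p─q⇒x∉q p ⁅ y ⁆ x∈p-y (x∈⁅x⁆ y)

x∈p-y⇒x∈p : x ∈ p - y → x ∈ p
x∈p-y⇒x∈p {p = p} {y = y} = p─q⊆p p ⁅ y ⁆

x∈p∪⁅x⁆ : x ∈ p ∪ ⁅ x ⁆
x∈p∪⁅x⁆ {x = x} {p = p} = q⊆p∪q p ⁅ x ⁆ (x∈⁅x⁆ x)

x∈p∪⁅y⁆⁻ : x ∈ p ∪ ⁅ y ⁆ → x ∈ p ⊎ x ≡ y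
x∈p∪⁅y⁆⁻ {p = p} {y = y} x∈p∪⁅y⁆ with x∈p∪q⁻ p ⁅ y ⁆ x∈p∪⁅y⁆
... | inj₁ x∈p    = inj₁ x∈p
... | inj₂ x∈⁅y⁆ = inj₂ (x∈⁅y⁆⇒x≡y y x∈⁅y⁆)

x∈p⇒⁅x⁆⊆p : x ∈ p → ⁅ x ⁆ ⊆ p
x∈p⇒⁅x⁆⊆p {x = x} {p = p} x∈p u∈⁅x⁆ = subst (_∈ p) (sym (x∈⁅y⁆⇒x≡y x u∈⁅x⁆)) x∈p

⁅x⁆∪⁅y⁆⊆p⁺ : x ∈ p → y ∈ p → ⁅ x ⁆ ∪ ⁅ y ⁆ ⊆ p
⁅x⁆∪⁅y⁆⊆p⁺ {x = x} {y = y} x∈p y∈p = [ x∈p⇒⁅x⁆⊆p x∈p , x∈p⇒⁅x⁆⊆p y∈p ]′ ∘ x∈p∪q⁻ ⁅ x ⁆ ⁅ y ⁆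

⁅x⁆∪⁅y⁆⊆p⁻ : ⁅ x ⁆ ∪ ⁅ y ⁆ ⊆ p → x ∈ p × y ∈ p
⁅x⁆∪⁅y⁆⊆p⁻ {x = x} {y = y} ⊆p = ⊆p (p⊆p∪q ⁅ y ⁆ (x∈⁅x⁆ x)) , ⊆p (q⊆p∪q ⁅ x ⁆ ⁅ y ⁆ (x∈⁅x⁆ y))

p∪⁅x⁆-x≡p : x ∉ p → (p ∪ ⁅ x ⁆) - x ≡ p
p∪⁅x⁆-x≡p {x = x} {p = p} x∉p = ⊆-antisym ⊆p ⊇p
  where
  ⊆p : (p ∪ ⁅ x ⁆) - x ⊆ p
  ⊆p u∈ with x∈p∪⁅y⁆⁻ (x∈p-y⇒x∈p u∈)
  ... | inj₁ u∈p = u∈p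
  ... | inj₂ u≡x = ⊥-elim (x∈p-y⇒x≢y u∈ u≡x)
  ⊇p : p ⊆ (p ∪ ⁅ x ⁆) - x
  ⊇p u∈p = x∈p∧x≢y⇒x∈p-y (p⊆p∪q ⁅ x ⁆ u∈p) (λ { refl → x∉p u∈p })

p-x∪⁅x⁆≡p : x ∈ p → (p - x) ∪ ⁅ x ⁆ ≡ p
p-x∪⁅x⁆≡p {x = x} {p = p} x∈p = ⊆-antisym ⊆p ⊇p
  where
  ⊆p : (p - x) ∪ ⁅ x ⁆ ⊆ p
  ⊆p u∈ with x∈p∪⁅y⁆⁻ u∈
  ... | inj₁ u∈p-x = x∈p-y⇒x∈p u∈p-x
  ... | inj₂ refl  = x∈p
  ⊇p : p ⊆ (p - x) ∪ ⁅ x ⁆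
  ⊇p {u} u∈p with u ≟ᶠ x
  ... | yes refl = x∈p∪⁅x⁆
  ... | no  u≢x  = p⊆p∪q ⁅ x ⁆ (x∈p∧x≢y⇒x∈p-y u∈p u≢x)

∣p∪⁅x⁆∣≡1+∣p∣ : x ∉ p → ∣ p ∪ ⁅ x ⁆ ∣ ≡ suc ∣ p ∣
∣p∪⁅x⁆∣≡1+∣p∣ {x = zero}  {p = outside ∷ p} _   = cong (suc ∘ ∣_∣) (∪-identityʳ p)
∣p∪⁅x⁆∣≡1+∣p∣ {x = zero}  {p = inside ∷ p}  x∉p = ⊥-elim (x∉p here)
∣p∪⁅x⁆∣≡1+∣p∣ {x = suc x} {p = outside ∷ p} x∉p = ∣p∪⁅x⁆∣≡1+∣p∣ (x∉p ∘ there)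
∣p∪⁅x⁆∣≡1+∣p∣ {x = suc x} {p = inside ∷ p}  x∉p = cong suc (∣p∪⁅x⁆∣≡1+∣p∣ (x∉p ∘ there))

p⊆q∧∣q∣≤∣p∣⇒p≡q : p ⊆ q → ∣ q ∣ ≤ ∣ p ∣ → p ≡ q
p⊆q∧∣q∣≤∣p∣⇒p≡q {p = p} {q = q} p⊆q ∣q∣≤∣p∣ = ⊆-antisym p⊆q q⊆p
  where
  q⊆p : q ⊆ p
  q⊆p {u} u∈q with u ∈? p
  ... | yes u∈p = u∈p
  ... | no  u∉p = ⊥-elim (<⇒≱ (p⊂q⇒∣p∣<∣q∣ (p⊆q , u , u∈q , u∉p)) ∣q∣≤∣p∣)

subsets : ∀ n → List (Subset n)
subsets zero = [] ∷ []
subsets (suc n) = List.map (inside ∷_) (subsets n) List.++ List.map (outside ∷_) (subsets n)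

∈-subsets : ∀ (p : Subset n) → p ∈ₗ subsets n
∈-subsets []            = here refl
∈-subsets (inside ∷ p)  = ∈-++⁺ˡ (∈-map⁺ (inside ∷_) (∈-subsets p))
∈-subsets (outside ∷ p) = ∈-++⁺ʳ _ (∈-map⁺ (outside ∷_) (∈-subsets p))

∃-largest : ∀ {A : Set} (f : A → ℕ) (a : A) (as : List A) →
            ∃ λ m → m ∈ₗ a ∷ as × (∀ {b} → b ∈ₗ a ∷ as → f b ≤ f m)
∃-largest f a as = argmax f a as , argmax∈ (argmax-sel f a as) , largest
  where
  argmax∈ : argmax f a as ≡ a ⊎ argmax f a as ∈ₗ as → argmax f a as ∈ₗ a ∷ as
  argmax∈ (inj₁ m≡a) = here m≡a
  argmax∈ (inj₂ m∈as) = there m∈as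
  largest : ∀ {b} → b ∈ₗ a ∷ as → f b ≤ f (argmax f a as)
  largest (here refl)  = f[⊥]≤f[argmax] {f = f} a as
  largest (there b∈as) = All.lookup (f[xs]≤f[argmax] {f = f} a as) b∈as

_≅_ : Complex n → Complex n → Set
K ≅ L = ∀ ρ → (K ρ → L ρ) × (L ρ → K ρ)

_∖_ : Complex n → Complex n → Complex n
(K ∖ L) ρ = K ρ × ¬ L ρ

DownwardClosed : Complex n → Set
DownwardClosed K = ∀ {ρ σ} → K ρ → Nonempty σ → σ ⊆ ρ → K σ

Deletion : Complex n → Subset n → Complex n
Deletion K τ = K ∖ (τ ⊆_)

collapses-respˡ : ∀ {K K′ L : Complex n} → K ≅ K′ → CollapsesOnto K L → CollapsesOnto K′ L
collapses-respˡ K≅K′ (same K≅L) =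
  same (λ ρ → proj₁ (K≅L ρ) ∘ proj₂ (K≅K′ ρ) , proj₁ (K≅K′ ρ) ∘ proj₂ (K≅L ρ))
collapses-respˡ K≅K′ (elem σ τ Kσ Kτ τ⊆σ ∣σ∣ free K↘L) =
  elem σ τ (proj₁ (K≅K′ σ) Kσ) (proj₁ (K≅K′ τ) Kτ) τ⊆σ ∣σ∣ (λ ρ → free ρ ∘ proj₂ (K≅K′ ρ))
    (collapses-respˡ (λ ρ → (λ (Kρ , ≢σ , ≢τ) → proj₁ (K≅K′ ρ) Kρ , ≢σ , ≢τ)
                          , (λ (K′ρ , ≢σ , ≢τ) → proj₂ (K≅K′ ρ) K′ρ , ≢σ , ≢τ)) K↘L)

collapses-trans : ∀ {K L M : Complex n} → CollapsesOnto K L → CollapsesOnto L M → CollapsesOnto K M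
collapses-trans (same K≅L) L↘M = collapses-respˡ (λ ρ → proj₂ (K≅L ρ) , proj₁ (K≅L ρ)) L↘M
collapses-trans (elem σ τ Kσ Kτ τ⊆σ ∣σ∣ free K↘L) L↘M =
  elem σ τ Kσ Kτ τ⊆σ ∣σ∣ free (collapses-trans K↘L L↘M)

collapses-respʳ : ∀ {K L M : Complex n} → CollapsesOnto K L → L ≅ M → CollapsesOnto K M
collapses-respʳ K↘L L≅M = collapses-trans K↘L (same L≅M)

module Matching {n} (x : Fin n) where

  Matched : Complex n → Complex n
  Matched D ρ = D ρ ⊎ (x ∈ ρ × D (ρ - x))

  record IsMatching (K D : Complex n) : Set where
    field
      simplex       : ∀ {σ} → D σ → K σ
      apex∉         : ∀ {σ} → D σ → x ∉ σ
      coface        : ∀ {σ} → D σ → K (σ ∪ ⁅ x ⁆)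
      upward-closed : ∀ {σ ρ} → D σ → K ρ → σ ⊂ ρ → Matched D ρ

  Without : Complex n → Subset n → Complex n
  Without K σ ρ = K ρ × ρ ≢ σ ∪ ⁅ x ⁆ × ρ ≢ σ

  module _ {K D : Complex n} (M : IsMatching K D) where
    open IsMatching M

    free-coface : ∀ {σ} → D σ → (∀ {ρ} → D ρ → ∣ ρ ∣ ≤ ∣ σ ∣) →
                  ∀ ρ → K ρ → σ ⊂ ρ → ρ ≡ σ ∪ ⁅ x ⁆
    free-coface {σ} Dσ largest ρ Kρ σ⊂ρ with upward-closed Dσ Kρ σ⊂ρ
    ... | inj₁ Dρ = ⊥-elim (<⇒≱ (p⊂q⇒∣p∣<∣q∣ σ⊂ρ) (largest Dρ))
    ... | inj₂ (x∈ρ , Dρ-x) = begin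
      ρ                ≡⟨ sym (p-x∪⁅x⁆≡p x∈ρ) ⟩
      (ρ - x) ∪ ⁅ x ⁆  ≡⟨ cong (_∪ ⁅ x ⁆) (sym σ≡ρ-x) ⟩
      σ ∪ ⁅ x ⁆        ∎
      where
      open ≡-Reasoning
      σ⊆ρ-x : σ ⊆ ρ - x
      σ⊆ρ-x u∈σ = x∈p∧x≢y⇒x∈p-y (proj₁ σ⊂ρ u∈σ) (λ { refl → apex∉ Dσ u∈σ })
      σ≡ρ-x : σ ≡ ρ - x
      σ≡ρ-x = p⊆q∧∣q∣≤∣p∣⇒p≡q σ⊆ρ-x (largest Dρ-x)

    module _ {σ} (Dσ : D σ) where

      private
        D′ : Complex n
        D′ ρ = D ρ × ρ ≢ σ

        ≢σ⇒-x≢σ : ∀ {ρ} → x ∈ ρ → ρ ≢ σ ∪ ⁅ x ⁆ → ρ - x ≢ σ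
        ≢σ⇒-x≢σ x∈ρ ρ≢ ρ-x≡σ = ρ≢ (trans (sym (p-x∪⁅x⁆≡p x∈ρ)) (cong (_∪ ⁅ x ⁆) ρ-x≡σ))

        matched-without : ∀ {ρ} → Without K σ ρ → Matched D ρ → Matched D′ ρ
        matched-without (_ , _ , ρ≢σ) (inj₁ Dρ) = inj₁ (Dρ , ρ≢σ)
        matched-without (_ , ρ≢ , _) (inj₂ (x∈ρ , Dρ-x)) = inj₂ (x∈ρ , Dρ-x , ≢σ⇒-x≢σ x∈ρ ρ≢)

      IsMatching-without : IsMatching (Without K σ) D′
      IsMatching-without = record
        { simplex = λ (Dτ , τ≢σ) → simplex Dτ , (λ { refl → apex∉ Dτ x∈p∪⁅x⁆ }) , τ≢σ
        ; apex∉   = apex∉ ∘ proj₁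
        ; coface  = λ (Dτ , τ≢σ) →
            coface Dτ
          , (λ τ∪x≡σ∪x → τ≢σ (trans (sym (p∪⁅x⁆-x≡p (apex∉ Dτ)))
                                     (trans (cong (_- x) τ∪x≡σ∪x) (p∪⁅x⁆-x≡p (apex∉ Dσ)))))
          , (λ τ∪x≡σ → apex∉ Dσ (subst (x ∈_) τ∪x≡σ x∈p∪⁅x⁆))
        ; upward-closed = λ (Dτ , _) K′ρ τ⊂ρ →
            matched-without K′ρ (upward-closed Dτ (proj₁ K′ρ) τ⊂ρ)
        }

      Without-unmatched : (Without K σ ∖ Matched D′) ≅ (K ∖ Matched D)
      Without-unmatched ρ = to , from
        where
        to : (Without K σ ∖ Matched D′) ρ → (K ∖ Matched D) ρ
        to (K′ρ , ¬m) = proj₁ K′ρ , ¬m ∘ matched-without K′ρ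
        from : (K ∖ Matched D) ρ → (Without K σ ∖ Matched D′) ρ
        from (Kρ , ¬m) =
            (Kρ , (λ { refl → ¬m (inj₂ (x∈p∪⁅x⁆ , subst D (sym (p∪⁅x⁆-x≡p (apex∉ Dσ))) Dσ)) })
                , (λ { refl → ¬m (inj₁ Dσ) }))
          , ¬m ∘ matched-D
          where
          matched-D : Matched D′ ρ → Matched D ρ
          matched-D (inj₁ (Dρ , _))         = inj₁ Dρ
          matched-D (inj₂ (x∈ρ , Dρ-x , _)) = inj₂ (x∈ρ , Dρ-x)

  -- The pairs (σ , σ ∪ ⁅ x ⁆) are collapsed with ∣ σ ∣ largest first, which makes
  -- σ ∪ ⁅ x ⁆ the only coface of σ (free-coface).
  matching-collapse : ∀ {K D} (xs : List (Subset n)) → (∀ {σ} → D σ ⇔ σ ∈ₗ xs) →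
                      IsMatching K D → CollapsesOnto K (K ∖ Matched D)
  matching-collapse σs = go (length σs) σs ≤-refl
    where
    go : ∀ k xs {K D} → length xs ≤ k → (∀ {σ} → D σ ⇔ σ ∈ₗ xs) →
         IsMatching K D → CollapsesOnto K (K ∖ Matched D)
    go _ [] {D = D} _ D⇔[] _ = same (λ ρ → (λ Kρ → Kρ , unmatched) , proj₁)
      where
      unmatched : ∀ {ρ} → ¬ Matched D ρ
      unmatched (inj₁ Dρ)       with () ← Equivalence.to D⇔[] Dρ
      unmatched (inj₂ (_ , Dρ)) with () ← Equivalence.to D⇔[] Dρ
    go (suc k) (a ∷ as) {K} {D} (s≤s ∣as∣≤k) D⇔xs M =
      elem (σ ∪ ⁅ x ⁆) σ (coface Dσ) (simplex Dσ) (p⊆p∪q ⁅ x ⁆) (sym (∣p∪⁅x⁆∣≡1+∣p∣ (apex∉ Dσ)))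
           (free-coface M Dσ (largest ∘ to D⇔xs))
           (collapses-respʳ (go k xs′ ∣xs′∣≤k D′⇔xs′ (IsMatching-without M Dσ))
                            (Without-unmatched M Dσ))
      where
      open IsMatching M
      open Equivalence
      xs = a ∷ as
      σ = proj₁ (∃-largest ∣_∣ a as)
      largest = proj₂ (proj₂ (∃-largest ∣_∣ a as))
      Dσ = from D⇔xs (proj₁ (proj₂ (∃-largest ∣_∣ a as)))
      ≢σ? : ∀ ρ → Dec (ρ ≢ σ)
      ≢σ? ρ = ¬? (≡-dec Bool._≟_ ρ σ)
      xs′ = filter ≢σ? xs
      ∣xs′∣≤k : length xs′ ≤ k
      ∣xs′∣≤k = ≤-trans (≤-pred (filter-notAll ≢σ? xs (Any.map (λ { refl ρ≢ρ → ρ≢ρ refl }) (to D⇔xs Dσ))))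
                        ∣as∣≤k
      D′⇔xs′ : ∀ {ρ} → (D ρ × ρ ≢ σ) ⇔ ρ ∈ₗ xs′
      D′⇔xs′ = mk⇔ (λ (Dρ , ρ≢σ) → ∈-filter⁺ ≢σ? (to D⇔xs Dρ) ρ≢σ)
                   (λ ρ∈xs′ → let ρ∈xs , ρ≢σ = ∈-filter⁻ ≢σ? ρ∈xs′ in from D⇔xs ρ∈xs , ρ≢σ)

module _ {K : Complex n} (K-closed : DownwardClosed K) (K? : Decidable K)
         {τ : Subset n} {x : Fin n} (τ≢∅ : Nonempty τ) (x∉τ : x ∉ τ)
         (cone : ∀ {σ} → K σ → τ ⊆ σ → K (σ ∪ ⁅ x ⁆)) where
  open Matching x

  private
    StarBase : Complex n
    StarBase σ = K σ × τ ⊆ σ × x ∉ σ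

    StarBase? : Decidable StarBase
    StarBase? σ = K? σ ×-dec τ ⊆? σ ×-dec ¬? (x ∈? σ)

    star-matched : ∀ {ρ} → K ρ → τ ⊆ ρ → Matched StarBase ρ
    star-matched {ρ} Kρ τ⊆ρ with x ∈? ρ
    ... | no  x∉ρ = inj₁ (Kρ , τ⊆ρ , x∉ρ)
    ... | yes x∈ρ = inj₂ (x∈ρ , K-closed Kρ ρ-x≢∅ x∈p-y⇒x∈p , τ⊆ρ-x , x∉p-x)
      where
      τ⊆ρ-x : τ ⊆ ρ - x
      τ⊆ρ-x u∈τ = x∈p∧x≢y⇒x∈p-y (τ⊆ρ u∈τ) (λ { refl → x∉τ u∈τ })
      ρ-x≢∅ : Nonempty (ρ - x)
      ρ-x≢∅ = proj₁ τ≢∅ , τ⊆ρ-x (proj₂ τ≢∅)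
      x∉p-x : x ∉ ρ - x
      x∉p-x x∈ρ-x = x∈p-y⇒x≢y x∈ρ-x refl

    matched-star : ∀ {ρ} → Matched StarBase ρ → τ ⊆ ρ
    matched-star (inj₁ (_ , τ⊆ρ , _))       = τ⊆ρ
    matched-star (inj₂ (_ , _ , τ⊆ρ-x , _)) = x∈p-y⇒x∈p ∘ τ⊆ρ-x

    star-matching : IsMatching K StarBase
    star-matching = record
      { simplex = proj₁
      ; apex∉   = proj₂ ∘ proj₂
      ; coface  = λ (Kσ , τ⊆σ , _) → cone Kσ τ⊆σ
      ; upward-closed = λ (_ , τ⊆σ , _) Kρ σ⊂ρ → star-matched Kρ (⊆-trans τ⊆σ (proj₁ σ⊂ρ))
      }

  collapses-onto-deletion : CollapsesOnto K (Deletion K τ)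
  collapses-onto-deletion =
    collapses-respʳ (matching-collapse (filter StarBase? (subsets n)) enumerates star-matching)
      λ ρ → (λ (Kρ , ¬m) → Kρ , ¬m ∘ star-matched Kρ) , (λ (Kρ , τ⊈ρ) → Kρ , τ⊈ρ ∘ matched-star)
    where
    enumerates : ∀ {σ} → StarBase σ ⇔ σ ∈ₗ filter StarBase? (subsets n)
    enumerates {σ} =
      mk⇔ (∈-filter⁺ StarBase? (∈-subsets σ)) (proj₂ ∘ ∈-filter⁻ StarBase? {xs = subsets n})

module _ (G : Graph) where

  private
    variable
      S T B σ ρ : Subset (size G)
      g u v w : V G

  Adj-sym : Adj G u v → Adj G v u
  Adj-sym {u} {v} = trans (Graph.sym G v u)

  Adj⇒≢ : Adj G u v → u ≢ v
  Adj⇒≢ {u} uv refl with () ← trans (sym uv) (irrefl G u)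

  ∈N⁻ : u ∈ N G S g → Adj G g u × u ∈ S
  ∈N⁻ {u} {S} {g} u∈N with g~u , u∈S ← x∈p∩q⁻ (tabulate (adj G g)) S u∈N =
    trans (sym (lookup∘tabulate (adj G g) u)) ([]=⇒lookup g~u) , u∈S

  ∈N⁺ : Adj G g u → u ∈ S → u ∈ N G S g
  ∈N⁺ {g} {u} g~u u∈S =
    x∈p∩q⁺ (lookup⇒[]= u (tabulate (adj G g)) (trans (lookup∘tabulate (adj G g) u) g~u) , u∈S)

  ∈N⇒≢ : u ∈ N G S g → u ≢ g
  ∈N⇒≢ = Adj⇒≢ ∘ Adj-sym ∘ proj₁ ∘ ∈N⁻

  CliqueComplex-closed : DownwardClosed (CliqueComplex G S)
  CliqueComplex-closed (_ , ρ⊆S , clique) σ≢∅ σ⊆ρ =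
    σ≢∅ , ⊆-trans σ⊆ρ ρ⊆S , λ u v u∈σ v∈σ → clique u v (σ⊆ρ u∈σ) (σ⊆ρ v∈σ)

  cliqueComplex? : Decidable (CliqueComplex G S)
  cliqueComplex? {S} σ = nonempty? σ ×-dec σ ⊆? S ×-dec all? λ u → all? λ v →
    u ∈? σ →-dec v ∈? σ →-dec ¬? (u ≟ᶠ v) →-dec adj G u v Bool.≟ true

  CliqueComplex-∪⁅⁆ : v ∈ S → (∀ {u} → u ∈ σ → u ≢ v → Adj G v u) →
                      CliqueComplex G S σ → CliqueComplex G S (σ ∪ ⁅ v ⁆)
  CliqueComplex-∪⁅⁆ {v} {S} {σ} v∈S v~σ (_ , σ⊆S , clique) = (v , x∈p∪⁅x⁆) , ⊆S , clique′
    where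
    ⊆S : σ ∪ ⁅ v ⁆ ⊆ S
    ⊆S u∈ with x∈p∪⁅y⁆⁻ u∈
    ... | inj₁ u∈σ = σ⊆S u∈σ
    ... | inj₂ refl = v∈S
    clique′ : ∀ u u′ → u ∈ σ ∪ ⁅ v ⁆ → u′ ∈ σ ∪ ⁅ v ⁆ → u ≢ u′ → Adj G u u′
    clique′ u u′ u∈ u′∈ u≢u′ with x∈p∪⁅y⁆⁻ u∈ | x∈p∪⁅y⁆⁻ u′∈
    ... | inj₁ u∈σ | inj₁ u′∈σ = clique u u′ u∈σ u′∈σ u≢u′
    ... | inj₁ u∈σ | inj₂ refl = Adj-sym (v~σ u∈σ u≢u′)
    ... | inj₂ refl | inj₁ u′∈σ = v~σ u′∈σ (u≢u′ ∘ sym)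
    ... | inj₂ refl | inj₂ refl = ⊥-elim (u≢u′ refl)

  -- For B ⊆ N G S g this is Δ(S - g) ∪ g ∗ Δ(B).
  LinkRestricted : Subset (size G) → V G → Subset (size G) → Complex (size G)
  LinkRestricted S g B ρ = CliqueComplex G S ρ × (g ∈ ρ → ρ - g ⊆ B)

  LinkRestricted-closed : DownwardClosed (LinkRestricted S g B)
  LinkRestricted-closed (Δρ , link) σ≢∅ σ⊆ρ =
      CliqueComplex-closed Δρ σ≢∅ σ⊆ρ
    , λ g∈σ u∈σ-g → link (σ⊆ρ g∈σ) (x∈p∧x≢y⇒x∈p-y (σ⊆ρ (x∈p-y⇒x∈p u∈σ-g)) (x∈p-y⇒x≢y u∈σ-g))

  linkRestricted? : Decidable (LinkRestricted S g B)
  linkRestricted? {g = g} {B} ρ = cliqueComplex? ρ ×-dec (g ∈? ρ →-dec ρ - g ⊆? B)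

  LinkRestricted-N : LinkRestricted S g (N G S g) ≅ CliqueComplex G S
  LinkRestricted-N ρ = proj₁ , λ Δρ@(_ , ρ⊆S , clique) → Δρ , λ g∈ρ u∈ρ-g →
    let u∈ρ = x∈p-y⇒x∈p u∈ρ-g in
    ∈N⁺ (clique _ _ g∈ρ u∈ρ (x∈p-y⇒x≢y u∈ρ-g ∘ sym)) (ρ⊆S u∈ρ)

  LinkRestricted-∪⁅⁆ : v ∈ B → v ∈ N G S g → (∀ {u} → u ∈ σ - g → u ≢ v → Adj G v u) →
                       LinkRestricted S g B σ → LinkRestricted S g B (σ ∪ ⁅ v ⁆)
  LinkRestricted-∪⁅⁆ {v = v} {B = B} {g = g} {σ = σ} v∈B v∈N v~σ-g (Δσ , link) =
    CliqueComplex-∪⁅⁆ (proj₂ (∈N⁻ v∈N)) v~σ Δσ , link′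
    where
    g~v = proj₁ (∈N⁻ v∈N)
    v~σ : ∀ {u} → u ∈ σ → u ≢ v → Adj G v u
    v~σ {u} u∈σ u≢v with u ≟ᶠ g
    ... | yes refl = Adj-sym g~v
    ... | no  u≢g  = v~σ-g (x∈p∧x≢y⇒x∈p-y u∈σ u≢g) u≢v
    link′ : g ∈ σ ∪ ⁅ v ⁆ → (σ ∪ ⁅ v ⁆) - g ⊆ B
    link′ g∈ u∈ with x∈p∪⁅y⁆⁻ g∈ | x∈p∪⁅y⁆⁻ (x∈p-y⇒x∈p u∈)
    ... | inj₂ g≡v | _        = ⊥-elim (∈N⇒≢ v∈N (sym g≡v))
    ... | inj₁ _   | inj₂ refl = v∈B
    ... | inj₁ g∈σ | inj₁ u∈σ = link g∈σ (x∈p∧x≢y⇒x∈p-y u∈σ (x∈p-y⇒x≢y u∈))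

  Deletion-LinkRestricted-apex : Deletion (LinkRestricted S g B) ⁅ g ⁆ ≅ CliqueComplex G (S - g)
  Deletion-LinkRestricted-apex {g = g} ρ = to , from
    where
    to : Deletion (LinkRestricted _ g _) ⁅ g ⁆ ρ → CliqueComplex G (_ - g) ρ
    to (((ρ≢∅ , ρ⊆S , clique) , _) , ⁅g⁆⊈ρ) =
      ρ≢∅ , (λ u∈ρ → x∈p∧x≢y⇒x∈p-y (ρ⊆S u∈ρ) (λ { refl → ⁅g⁆⊈ρ (x∈p⇒⁅x⁆⊆p u∈ρ) })) , clique
    from : CliqueComplex G (_ - g) ρ → Deletion (LinkRestricted _ g _) ⁅ g ⁆ ρ
    from (ρ≢∅ , ρ⊆S-g , clique) =
      ((ρ≢∅ , x∈p-y⇒x∈p ∘ ρ⊆S-g , clique) , ⊥-elim ∘ g∉ρ) , λ ⁅g⁆⊆ρ → g∉ρ (⁅g⁆⊆ρ (x∈⁅x⁆ g))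
      where
      g∉ρ : g ∉ ρ
      g∉ρ g∈ρ = x∈p-y⇒x≢y (ρ⊆S-g g∈ρ) refl

  Deletion-LinkRestricted-edge : v ≢ g →
    Deletion (LinkRestricted S g B) (⁅ g ⁆ ∪ ⁅ v ⁆) ≅ LinkRestricted S g (B - v)
  Deletion-LinkRestricted-edge v≢g ρ = to , from
    where
    to : Deletion (LinkRestricted _ _ _) _ ρ → LinkRestricted _ _ _ ρ
    to ((Δρ , link) , ⊈ρ) = Δρ , λ g∈ρ u∈ρ-g →
      x∈p∧x≢y⇒x∈p-y (link g∈ρ u∈ρ-g) (λ { refl → ⊈ρ (⁅x⁆∪⁅y⁆⊆p⁺ g∈ρ (x∈p-y⇒x∈p u∈ρ-g)) })
    from : LinkRestricted _ _ _ ρ → Deletion (LinkRestricted _ _ _) _ ρ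
    from (Δρ , link) = (Δρ , λ g∈ρ → x∈p-y⇒x∈p ∘ link g∈ρ) , λ ⊆ρ →
      let g∈ρ , v∈ρ = ⁅x⁆∪⁅y⁆⊆p⁻ ⊆ρ in
      x∈p-y⇒x≢y (link g∈ρ (x∈p∧x≢y⇒x∈p-y v∈ρ v≢g)) refl

  single-collapse : v ∈ N G S g → CollapsesOnto (LinkRestricted S g ⁅ v ⁆) (CliqueComplex G (S - g))
  single-collapse {v} {g = g} v∈N =
    collapses-respʳ (collapses-onto-deletion LinkRestricted-closed linkRestricted?
                       (g , x∈⁅x⁆ g) (x≢y⇒x∉⁅y⁆ (∈N⇒≢ v∈N)) cone)
                    Deletion-LinkRestricted-apex
    where
    cone : LinkRestricted _ g ⁅ v ⁆ σ → ⁅ g ⁆ ⊆ σ → LinkRestricted _ g ⁅ v ⁆ (σ ∪ ⁅ v ⁆)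
    cone Lσ@(_ , link) ⁅g⁆⊆σ = LinkRestricted-∪⁅⁆ (x∈⁅x⁆ v) v∈N
      (λ u∈σ-g u≢v → ⊥-elim (u≢v (x∈⁅y⁆⇒x≡y v (link (⁅g⁆⊆σ (x∈⁅x⁆ g)) u∈σ-g)))) Lσ

  peel-collapse : B ⊆ N G S g → v ∈ B → w ∈ B → Dominated G B v w →
                  CollapsesOnto (LinkRestricted S g B) (LinkRestricted S g (B - v))
  peel-collapse {B} {g = g} {v} {w} B⊆N v∈B w∈B (w≢v , dominates) =
    collapses-respʳ (collapses-onto-deletion LinkRestricted-closed linkRestricted?
                       (g , p⊆p∪q ⁅ v ⁆ (x∈⁅x⁆ g)) w∉τ cone)
                    (Deletion-LinkRestricted-edge (∈N⇒≢ (B⊆N v∈B)))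
    where
    w∈N = B⊆N w∈B
    w∉τ : w ∉ ⁅ g ⁆ ∪ ⁅ v ⁆
    w∉τ = [ ∈N⇒≢ w∈N ∘ x∈⁅y⁆⇒x≡y g , w≢v ∘ x∈⁅y⁆⇒x≡y v ]′ ∘ x∈p∪q⁻ ⁅ g ⁆ ⁅ v ⁆
    cone : LinkRestricted _ g B σ → ⁅ g ⁆ ∪ ⁅ v ⁆ ⊆ σ → LinkRestricted _ g B (σ ∪ ⁅ w ⁆)
    cone {σ} Lσ@((_ , _ , clique) , link) ⊆σ = LinkRestricted-∪⁅⁆ w∈B w∈N w~σ-g Lσ
      where
      g∈σ = proj₁ (⁅x⁆∪⁅y⁆⊆p⁻ ⊆σ)
      v∈σ = proj₂ (⁅x⁆∪⁅y⁆⊆p⁻ ⊆σ)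
      σ⊆N[v] : ∀ {u} → u ∈ σ → InClosedN G v u
      σ⊆N[v] {u} u∈σ with u ≟ᶠ v
      ... | yes u≡v = inj₁ u≡v
      ... | no  u≢v = inj₂ (clique v u v∈σ u∈σ (u≢v ∘ sym))
      w~σ-g : ∀ {u} → u ∈ σ - g → u ≢ w → Adj G w u
      w~σ-g {u} u∈σ-g u≢w with dominates u (link g∈σ u∈σ-g) (σ⊆N[v] (x∈p-y⇒x∈p u∈σ-g))
      ... | inj₁ u≡w = ⊥-elim (u≢w u≡w)
      ... | inj₂ w~u = w~u

  dismantlable-link-collapse : B ⊆ N G S g → Dismantlable G B →
                               CollapsesOnto (LinkRestricted S g B) (CliqueComplex G (S - g))
  dismantlable-link-collapse B⊆N (single v refl) = single-collapse (B⊆N (x∈⁅x⁆ v))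
  dismantlable-link-collapse B⊆N (peel v w v∈B w∈B dominated B-v) =
    collapses-trans (peel-collapse B⊆N v∈B w∈B dominated)
                    (dismantlable-link-collapse (B⊆N ∘ x∈p-y⇒x∈p) B-v)

  s-dismantlable-collapse : SDismantlable G S g →
                            CollapsesOnto (CliqueComplex G S) (CliqueComplex G (S - g))
  s-dismantlable-collapse = collapses-respˡ LinkRestricted-N ∘ dismantlable-link-collapse id

  ↘ˢ⇒collapses : _↘ˢ_ G S T → CollapsesOnto (CliqueComplex G S) (CliqueComplex G T)
  ↘ˢ⇒collapses done = same (λ _ → id , id)
  ↘ˢ⇒collapses (del g _ sdism rest) =
    collapses-trans (s-dismantlable-collapse sdism) (↘ˢ⇒collapses rest)

proposition2p3 : (G : Graph) (T : Subset (size G)) →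
    _↘ˢ_ G ⊤ T → CollapsesOnto (CliqueComplex G ⊤) (CliqueComplex G T)
proposition2p3 G T = ↘ˢ⇒collapses G
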